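{- Let $c=pqrs$ be a conductor of cyclic cubic fields with four prime-power divisors $p,q,r,s$ (distinct primes $\equiv1\pmod 3$, or the prime power $9$). Let $\mathcal{G}$ be the directed graph on the vertex set $\{p,q,r,s\}$ with an arrow $x\to y$ ($x\ne y$) iff $\left(\frac{x}{y}\right)_3=1$. Suppose $\mathcal{G}$ satisfies: (1) there is no pair $x,y$ with both $x\to y$ and $y\to x$; (2) there is no attractive vertex; (3) there is no repulsive vertex; (4) for every $3$-element subset $\{x,y,z\}$ of vertices spanning no arrows, the invariant $\delta=a_{xy}a_{yz}a_{zx}-a_{xz}a_{zy}a_{yx}$ satisfies $\delta\not\equiv0\pmod 3$. Then for each of the four $3$-element subsets $\{p,q,r\},\{p,q,s\},\{p,r,s\},\{q,r,s\}$ the induced subgraph is of one of the types III.1, III.2, III.3, III.4; and $\mathcal{G}$ is isomorphic (as a directed graph) to one of the following seven graphs: (i) no arrows; (ii) $p\to q$ only; (iii) $p\to q$, $r\to s$ only; (iv) $p\to q\to r$ only; (v) $p\to q\to r\to p$ only; (vi) $p\to q\to r\to s$ only; (vii) $p\to q\to r\to s\to p$ only.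
   Context: Cubic residue symbols: $\left(\frac{x}{y}\right)_3=\zeta_3^{a_{xy}}$ with $a_{xy}\in\{ -1,0,1\}$ (values in the cube roots of unity, with respect to fixed choices of primes of $\mathbb{Z}[\zeta_3]$ above the divisors; for the divisor $9$ the usual conventions apply), so $x\to y$ iff $a_{xy}=0$. A vertex $v$ is attractive if there are two distinct other vertices $u,w$ with $u\to v$ and $w\to v$; it is repulsive if there are two distinct other vertices $u,w$ with $v\to u$ and $v\to w$. Types of a directed graph on three vertices $\{x,y,z\}$: III.1 = no arrows and $\delta\not\equiv 0\pmod 3$ (with $\delta$ as in the claim); III.2 = exactly one arrow; III.3 = exactly two arrows, forming a directed path $x\to y\to z$ (for some ordering); III.4 = exactly three arrows, forming a directed $3$-cycle $x\to y\to z\to x$. A graph satisfying (1)–(4) is called the graph of a tame octet. -}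

module Defs where

open import Data.Nat as ℕ using (ℕ; zero; suc; _∸_; _^_; _≡ᵇ_)
open import Data.Nat.DivMod using (_%_; _/_)
open import Data.Nat.Primality using (Prime)
open import Data.Integer as ℤ using (ℤ; +_; -[1+_]; 0ℤ)
open import Data.Integer.Divisibility as ℤD using ()
open import Data.Fin using (Fin; zero; suc)
open import Data.Fin.Permutation using (Permutation′; _⟨$⟩ʳ_)
open import Data.Bool using (Bool; true; false; if_then_else_)
open import Data.List using (List; []; _∷_)
open import Data.List.Membership.Propositional using (_∈_)
open import Data.Product using (Σ; ∃; _×_; _,_)
open import Data.Sum using (_⊎_)
open import Relation.Nullary using (¬_; does)
open import Relation.Binary.PropositionalEquality using (_≡_; _≢_)

-- m mod y (with m mod 0 = m, a case that never occurs for our divisors)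
modN : ℕ → ℕ → ℕ
modN m zero    = m
modN m (suc n) = m % suc n

ConductorDivisor : ℕ → Set
ConductorDivisor y = (Prime y × y % 3 ≡ 1) ⊎ y ≡ 9

-- Fixed choice of a prime of ℤ[ζ₃] above the divisor y, encoded by the
-- image w of ζ₃ in the residue ring: a nontrivial cube root of unity mod y.
CubeRootChoice : ℕ → ℕ → Set
CubeRootChoice y w = modN (w ^ 3) y ≡ 1 × modN w y ≢ 1

-- numerator convention: the divisor 9 enters the symbol as the prime 3
numer : ℕ → ℕ
numer x = if x ≡ᵇ 9 then 3 else x

-- exponent of the cubic character mod y:
-- (y-1)/3 for a prime y, and 2 for y = 9 (x ↦ x² maps (ℤ/9)ˣ onto its
-- subgroup {1,4,7} of cube roots of unity, with kernel {±1}).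
charExp : ℕ → ℕ
charExp y = if y ≡ᵇ 9 then 2 else (y ∸ 1) / 3

-- a_{xy} ∈ {-1,0,1} where (x/y)₃ = ζ₃^{a_{xy}}, relative to the choice w
-- (ζ₃ ≡ w).  Returns 0 in the (never occurring) non-coprime case.
cubicSym : (w y x : ℕ) → ℤ
cubicSym w y x =
  let v = modN (numer x ^ charExp y) y in
  if does (v ℕ.≟ modN 1 y) then 0ℤ
  else if does (v ℕ.≟ modN w y) then + 1
  else if does (v ℕ.≟ modN (w ^ 2) y) then -[1+ 0 ]
  else 0ℤ

symMat : (d w : Fin 4 → ℕ) → Fin 4 → Fin 4 → ℤ
symMat d w i j = cubicSym (w j) (d j) (d i)

Digraph : ℕ → Set₁
Digraph n = Fin n → Fin n → Set

Arrow : {n : ℕ} → (Fin n → Fin n → ℤ) → Digraph n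
Arrow a x y = x ≢ y × a x y ≡ 0ℤ

δ : {n : ℕ} → (Fin n → Fin n → ℤ) → Fin n → Fin n → Fin n → ℤ
δ a x y z = a x y ℤ.* a y z ℤ.* a z x ℤ.- a x z ℤ.* a z y ℤ.* a y x

NotDivBy3 : ℤ → Set
NotDivBy3 t = ¬ (+ 3 ℤD.∣ t)

_≅_ : {n : ℕ} → Digraph n → Digraph n → Set
_≅_ {n} R S = Σ (Permutation′ n) λ σ → ∀ i j →
  (R i j → S (σ ⟨$⟩ʳ i) (σ ⟨$⟩ʳ j)) × (S (σ ⟨$⟩ʳ i) (σ ⟨$⟩ʳ j) → R i j)

fromEdges : {n : ℕ} → List (Fin n × Fin n) → Digraph n
fromEdges L i j = (i , j) ∈ L

NoMutual : {n : ℕ} → Digraph n → Set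
NoMutual G = ∀ x y → ¬ (G x y × G y x)

Attractive : {n : ℕ} → Digraph n → Fin n → Set
Attractive G v = ∃ λ u → ∃ λ w → u ≢ w × u ≢ v × w ≢ v × G u v × G w v

Repulsive : {n : ℕ} → Digraph n → Fin n → Set
Repulsive G v = ∃ λ u → ∃ λ w → u ≢ w × u ≢ v × w ≢ v × G v u × G v w

Distinct3 : {n : ℕ} → Fin n → Fin n → Fin n → Set
Distinct3 x y z = x ≢ y × y ≢ z × x ≢ z

NoArrowsOn : {n : ℕ} → Digraph n → Fin n → Fin n → Fin n → Set
NoArrowsOn G x y z =
  ¬ G x y × ¬ G y x × ¬ G y z × ¬ G z y × ¬ G x z × ¬ G z x

Cond4 : {n : ℕ} → (Fin n → Fin n → ℤ) → Set
Cond4 a = ∀ x y z → Distinct3 x y z → NoArrowsOn (Arrow a) x y z →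
  NotDivBy3 (δ a x y z)

TameOctetGraph : {n : ℕ} → (Fin n → Fin n → ℤ) → Set
TameOctetGraph a = NoMutual (Arrow a) × (∀ v → ¬ Attractive (Arrow a) v)
  × (∀ v → ¬ Repulsive (Arrow a) v) × Cond4 a

0F 1F 2F : Fin 3
0F = zero
1F = suc zero
2F = suc (suc zero)

triple : {n : ℕ} → Fin n → Fin n → Fin n → Fin 3 → Fin n
triple x y z zero = x
triple x y z (suc zero) = y
triple x y z (suc (suc zero)) = z

induced3 : {n : ℕ} → Digraph n → Fin n → Fin n → Fin n → Digraph 3
induced3 G x y z i j = G (triple x y z i) (triple x y z j)

TypeIII : {n : ℕ} → (Fin n → Fin n → ℤ) → Fin n → Fin n → Fin n → Set
TypeIII a x y z =
    (H ≅ fromEdges [] × NotDivBy3 (δ a x y z))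
  ⊎ (H ≅ fromEdges ((0F , 1F) ∷ []))
  ⊎ (H ≅ fromEdges ((0F , 1F) ∷ (1F , 2F) ∷ []))
  ⊎ (H ≅ fromEdges ((0F , 1F) ∷ (1F , 2F) ∷ (2F , 0F) ∷ []))
  where H = induced3 (Arrow a) x y z

p q r s : Fin 4
p = zero
q = suc zero
r = suc (suc zero)
s = suc (suc (suc zero))

sevenGraphs : Fin 7 → List (Fin 4 × Fin 4)
sevenGraphs zero = []
sevenGraphs (suc zero) = (p , q) ∷ []
sevenGraphs (suc (suc zero)) = (p , q) ∷ (r , s) ∷ []
sevenGraphs (suc (suc (suc zero))) = (p , q) ∷ (q , r) ∷ []
sevenGraphs (suc (suc (suc (suc zero)))) = (p , q) ∷ (q , r) ∷ (r , p) ∷ []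
sevenGraphs (suc (suc (suc (suc (suc zero))))) =
  (p , q) ∷ (q , r) ∷ (r , s) ∷ []
sevenGraphs (suc (suc (suc (suc (suc (suc zero)))))) =
  (p , q) ∷ (q , r) ∷ (r , s) ∷ (s , p) ∷ []

-- Conditions (1)–(3) say that there are no loops or 2-cycles and that no vertex has two
-- in-arrows or two out-arrows, so the arrow graph is a disjoint union of directed paths and of
-- directed cycles of length at least 3.  On four vertices these are exactly the seven listed
-- graphs; on three vertices they are the shapes of III.1–III.4, with condition (4) supplying
-- δ ≢ 0 (mod 3) in the arrowless case.  Since out-degrees are at most one, such a graph is the
-- graph of a partial map on its vertices, and both finite classifications are checked by
-- evaluation over all 4³ resp. 5⁴ partial maps, finding each isomorphism among all permutations.
{-# OPTIONS --safe #-}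
module Submission where

open import Defs
open import Data.Empty using (⊥-elim)
open import Data.Fin using (Fin; zero; suc; _≟_)
open import Data.Fin.Permutation using (Permutation′; _⟨$⟩ʳ_; id; insert)
open import Data.Fin.Properties using (all?; any?)
open import Data.Integer as ℤ using (ℤ; 0ℤ)
open import Data.List using (List; []; _∷_; map; concatMap; allFin)
open import Data.List.Membership.DecPropositional using (_∈?_)
open import Data.List.Relation.Unary.Any as Any using (Any)
open import Data.Maybe as Maybe using (Maybe; nothing; just)
open import Data.Maybe.Properties as Maybe using ()
open import Data.Nat using (ℕ; zero; suc)
open import Data.Product using (Σ; ∃; _×_; _,_; proj₁; proj₂)
open import Data.Product.Properties using (≡-dec)
open import Data.Sum using (inj₁; inj₂)
open import Data.Vec using (Vec; []; _∷_; lookup; tabulate)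
open import Data.Vec.Properties using (lookup∘tabulate)
open import Function using (_∘_)
open import Function.Definitions using (Injective)
open import Level using (0ℓ)
open import Relation.Binary.Core using (_⇒_; _⇔_; _=[_]⇒_)
open import Relation.Binary.Definitions using (Decidable)
open import Relation.Binary.PropositionalEquality using (_≡_; _≢_; refl; sym; cong)
open import Relation.Nullary using (Dec; yes; no; ¬_; ¬?; _×-dec_; _→-dec_)
open import Relation.Nullary.Decidable using (map′; from-yes; dec⇒maybe)
open import Relation.Unary as U using (Pred)

private variable
  m n : ℕ
  G H R S : Digraph n

TameShape : Digraph n → Set
TameShape G = NoMutual G × (∀ v → ¬ Attractive G v) × (∀ v → ¬ Repulsive G v)

tameShape? : Decidable G → Dec (TameShape G)
tameShape? G? =
  all? (λ x → all? λ y → ¬? (G? x y ×-dec G? y x)) ×-dec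
  all? (λ v → ¬? (any? λ u → any? λ w →
    ¬? (u ≟ w) ×-dec ¬? (u ≟ v) ×-dec ¬? (w ≟ v) ×-dec G? u v ×-dec G? w v)) ×-dec
  all? (λ v → ¬? (any? λ u → any? λ w →
    ¬? (u ≟ w) ×-dec ¬? (u ≟ v) ×-dec ¬? (w ≟ v) ×-dec G? v u ×-dec G? v w))

tameShape-pullback : {f : Fin m → Fin n} → Injective _≡_ _≡_ f →
                     S =[ f ]⇒ G → TameShape G → TameShape S
tameShape-pullback {f = f} f-inj S⇒G (noMutual , noAttr , noRep) =
    (λ x y (sxy , syx) → noMutual (f x) (f y) (S⇒G sxy , S⇒G syx))
  , (λ v (u , w , u≢w , u≢v , w≢v , suv , swv) →
       noAttr (f v) (f u , f w , u≢w ∘ f-inj , u≢v ∘ f-inj , w≢v ∘ f-inj , S⇒G suv , S⇒G swv))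
  , (λ v (u , w , u≢w , u≢v , w≢v , svu , svw) →
       noRep (f v) (f u , f w , u≢w ∘ f-inj , u≢v ∘ f-inj , w≢v ∘ f-inj , S⇒G svu , S⇒G svw))

loopless : TameShape G → ∀ i → ¬ G i i
loopless (noMutual , _) i g = noMutual i i (g , g)

out-neighbour-unique : TameShape G → ∀ {i j k} → G i j → G i k → j ≡ k
out-neighbour-unique {G = G} tame@(_ , _ , noRep) {i} {j} {k} gij gik with j ≟ k
... | yes j≡k = j≡k
... | no j≢k  = ⊥-elim (noRep i (j , k , j≢k , ≢i gij , ≢i gik , gij , gik))
  where
  ≢i : ∀ {l} → G i l → l ≢ i
  ≢i gil refl = loopless tame i gil

triple-injective : {x y z : Fin n} → Distinct3 x y z → Injective _≡_ _≡_ (triple x y z)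
triple-injective _             {zero}           {zero}           _ = refl
triple-injective _             {suc zero}       {suc zero}       _ = refl
triple-injective _             {suc (suc zero)} {suc (suc zero)} _ = refl
triple-injective (x≢y , _ , _) {zero}           {suc zero}       e = ⊥-elim (x≢y e)
triple-injective (x≢y , _ , _) {suc zero}       {zero}           e = ⊥-elim (x≢y (sym e))
triple-injective (_ , y≢z , _) {suc zero}       {suc (suc zero)} e = ⊥-elim (y≢z e)
triple-injective (_ , y≢z , _) {suc (suc zero)} {suc zero}       e = ⊥-elim (y≢z (sym e))
triple-injective (_ , _ , x≢z) {zero}           {suc (suc zero)} e = ⊥-elim (x≢z e)
triple-injective (_ , _ , x≢z) {suc (suc zero)} {zero}           e = ⊥-elim (x≢z (sym e))

IsoVia : Permutation′ n → Digraph n → Digraph n → Set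
IsoVia σ R S = ∀ i j → (R i j → S (σ ⟨$⟩ʳ i) (σ ⟨$⟩ʳ j)) × (S (σ ⟨$⟩ʳ i) (σ ⟨$⟩ʳ j) → R i j)

isoVia? : Decidable R → Decidable S → ∀ σ → Dec (IsoVia σ R S)
isoVia? R? S? σ = all? λ i → all? λ j →
  (R? i j →-dec S? (σ ⟨$⟩ʳ i) (σ ⟨$⟩ʳ j)) ×-dec (S? (σ ⟨$⟩ʳ i) (σ ⟨$⟩ʳ j) →-dec R? i j)

≅-respˡ-⇔ : R ⇔ S → R ≅ H → S ≅ H
≅-respˡ-⇔ (R⇒S , S⇒R) (σ , iso) = σ , λ i j →
  (λ s → proj₁ (iso i j) (S⇒R s)) , (λ h → R⇒S (proj₂ (iso i j) h))

permutations : ∀ n → List (Permutation′ n)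
permutations zero    = id ∷ []
permutations (suc n) = concatMap (λ j → map (insert zero j) (permutations n)) (allFin (suc n))

IsoBySearch : Digraph n → Digraph n → Set
IsoBySearch {n} R S = Any (λ σ → IsoVia σ R S) (permutations n)

isoBySearch? : Decidable R → Decidable S → Dec (IsoBySearch R S)
isoBySearch? R? S? = Any.any? (isoVia? R? S?) _

fromEdges? : (L : List (Fin n × Fin n)) → Decidable (fromEdges L)
fromEdges? L i j = _∈?_ (≡-dec _≟_ _≟_) (i , j) L

IsomorphicToOneOf : (Fin m → List (Fin n × Fin n)) → Digraph n → Set
IsomorphicToOneOf shapes G = ∃ λ k → G ≅ fromEdges (shapes k)

IsomorphicToOneOfBySearch : (Fin m → List (Fin n × Fin n)) → Digraph n → Set
IsomorphicToOneOfBySearch shapes G = ∃ λ k → IsoBySearch G (fromEdges (shapes k))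

isomorphicToOneOfBySearch? : (shapes : Fin m → List (Fin n × Fin n)) → Decidable G →
                             Dec (IsomorphicToOneOfBySearch shapes G)
isomorphicToOneOfBySearch? shapes G? = any? λ k → isoBySearch? G? (fromEdges? (shapes k))

Successors : ℕ → Set
Successors n = Vec (Maybe (Fin n)) n

⟦_⟧ : Successors n → Digraph n
⟦ f ⟧ i j = lookup f i ≡ just j

⟦_⟧? : (f : Successors n) → Decidable ⟦ f ⟧
⟦ f ⟧? i j = Maybe.≡-dec _≟_ (lookup f i) (just j)

successor : {G : Digraph n} → Decidable G → Fin n → Maybe (Fin n)
successor G? i = Maybe.map proj₁ (dec⇒maybe (any? (G? i)))

successors : {G : Digraph n} → Decidable G → Successors n
successors G? = tabulate (successor G?)

successors-⇔ : (G? : Decidable G) → (∀ {i j k} → G i j → G i k → j ≡ k) →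
               ⟦ successors G? ⟧ ⇔ G
successors-⇔ {G = G} G? unique = to , from
  where
  to : ⟦ successors G? ⟧ ⇒ G
  to {i} {j} e rewrite lookup∘tabulate (successor G?) i with any? (G? i) | e
  ... | yes (k , gik) | refl = gik
  from : G ⇒ ⟦ successors G? ⟧
  from {i} {j} gij rewrite lookup∘tabulate (successor G?) i with any? (G? i)
  ... | yes (k , gik) = cong just (unique gik gij)
  ... | no ∄k         = ⊥-elim (∄k (j , gij))

Exhaustible : Set → Set₁
Exhaustible A = {P : Pred A 0ℓ} → U.Decidable P → Dec (∀ a → P a)

exhaustible-Vec : {A : Set} → Exhaustible A → ∀ n → Exhaustible (Vec A n)
exhaustible-Vec ∀A? zero    P? = map′ (λ { p [] → p }) (λ h → h []) (P? [])
exhaustible-Vec ∀A? (suc n) P? =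
  map′ (λ { h (x ∷ xs) → h x xs }) (λ h x xs → h (x ∷ xs))
       (∀A? λ x → exhaustible-Vec ∀A? n λ xs → P? (x ∷ xs))

exhaustible-Maybe : {A : Set} → Exhaustible A → Exhaustible (Maybe A)
exhaustible-Maybe ∀A? P? =
  map′ (λ { (none , some) nothing → none ; (none , some) (just x) → some x })
       (λ h → h nothing , λ x → h (just x))
       (P? nothing ×-dec ∀A? (P? ∘ just))

exhaustible-Successors : ∀ n → Exhaustible (Successors n)
exhaustible-Successors n = exhaustible-Vec (exhaustible-Maybe all?) n

ClassifiesTame : (Fin m → List (Fin n × Fin n)) → Set
ClassifiesTame {n = n} shapes =
  ∀ (f : Successors n) → TameShape ⟦ f ⟧ → IsomorphicToOneOfBySearch shapes ⟦ f ⟧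

classifiesTame? : (shapes : Fin m → List (Fin n × Fin n)) → Dec (ClassifiesTame shapes)
classifiesTame? {n = n} shapes =
  exhaustible-Successors n λ f → tameShape? ⟦ f ⟧? →-dec isomorphicToOneOfBySearch? shapes ⟦ f ⟧?

classify-by-search : (shapes : Fin m → List (Fin n × Fin n)) → ClassifiesTame shapes →
                     {G : Digraph n} → Decidable G → TameShape G → IsomorphicToOneOf shapes G
classify-by-search shapes classified {G} G? tame =
  let k , iso = classified (successors G?) (tameShape-pullback (λ e → e) (proj₁ f⇔G) tame)
  in k , ≅-respˡ-⇔ {H = fromEdges (shapes k)} f⇔G (Any.satisfied iso)
  where
  f⇔G : ⟦ successors G? ⟧ ⇔ G
  f⇔G = successors-⇔ G? (out-neighbour-unique tame)

triangleShapes : Fin 4 → List (Fin 3 × Fin 3)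
triangleShapes zero                   = []
triangleShapes (suc zero)             = (0F , 1F) ∷ []
triangleShapes (suc (suc zero))       = (0F , 1F) ∷ (1F , 2F) ∷ []
triangleShapes (suc (suc (suc zero))) = (0F , 1F) ∷ (1F , 2F) ∷ (2F , 0F) ∷ []

triangleShapes-classifyTame : ClassifiesTame triangleShapes
triangleShapes-classifyTame = from-yes (classifiesTame? triangleShapes)

classify₃ : {G : Digraph 3} → Decidable G → TameShape G → IsomorphicToOneOf triangleShapes G
classify₃ = classify-by-search triangleShapes triangleShapes-classifyTame

sevenGraphs-classifyTame : ClassifiesTame sevenGraphs
sevenGraphs-classifyTame = from-yes (classifiesTame? sevenGraphs)

classify₄ : {G : Digraph 4} → Decidable G → TameShape G → IsomorphicToOneOf sevenGraphs G
classify₄ = classify-by-search sevenGraphs sevenGraphs-classifyTame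

arrow? : (a : Fin n → Fin n → ℤ) → Decidable (Arrow a)
arrow? a x y = ¬? (x ≟ y) ×-dec a x y ℤ.≟ 0ℤ

empty⇒noArrowsOn : {x y z : Fin n} → induced3 G x y z ≅ fromEdges [] → NoArrowsOn G x y z
empty⇒noArrowsOn {G = G} {x} {y} {z} (_ , iso) =
  noArrow 0F 1F , noArrow 1F 0F , noArrow 1F 2F , noArrow 2F 1F , noArrow 0F 2F , noArrow 2F 0F
  where
  noArrow : ∀ i j → ¬ induced3 G x y z i j
  noArrow i j g with proj₁ (iso i j) g
  ... | ()

shape⇒typeIII : {a : Fin n → Fin n → ℤ} {x y z : Fin n} → Cond4 a → Distinct3 x y z →
                IsomorphicToOneOf triangleShapes (induced3 (Arrow a) x y z) → TypeIII a x y z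
shape⇒typeIII {a = a} {x} {y} {z} cond4 distinct (zero , iso) =
  inj₁ (iso , cond4 x y z distinct (empty⇒noArrowsOn {G = Arrow a} iso))
shape⇒typeIII _ _ (suc zero , iso)             = inj₂ (inj₁ iso)
shape⇒typeIII _ _ (suc (suc zero) , iso)       = inj₂ (inj₂ (inj₁ iso))
shape⇒typeIII _ _ (suc (suc (suc zero)) , iso) = inj₂ (inj₂ (inj₂ iso))

typeIII : {a : Fin n → Fin n → ℤ} {x y z : Fin n} → Cond4 a → TameShape (Arrow a) →
          Distinct3 x y z → TypeIII a x y z
typeIII {a = a} {x} {y} {z} cond4 tame distinct =
  shape⇒typeIII cond4 distinct
    (classify₃ (λ i j → arrow? a (triple x y z i) (triple x y z j))
               (tameShape-pullback (triple-injective distinct) (λ g → g) tame))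

theoremA : (d : Fin 4 → ℕ) → (∀ i j → d i ≡ d j → i ≡ j)
    → (∀ i → ConductorDivisor (d i))
    → (w : Fin 4 → ℕ) → (∀ i → CubeRootChoice (d i) (w i))
    → TameOctetGraph (symMat d w)
    → (TypeIII (symMat d w) p q r × TypeIII (symMat d w) p q s
        × TypeIII (symMat d w) p r s × TypeIII (symMat d w) q r s)
      × Σ (Fin 7) (λ k → Arrow (symMat d w) ≅ fromEdges (sevenGraphs k))
theoremA d _ _ w _ (noMutual , noAttr , noRep , cond4) =
    ( typeIIIₐ ((λ ()) , (λ ()) , (λ ())) , typeIIIₐ ((λ ()) , (λ ()) , (λ ()))
    , typeIIIₐ ((λ ()) , (λ ()) , (λ ())) , typeIIIₐ ((λ ()) , (λ ()) , (λ ())) )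
  , classify₄ (arrow? (symMat d w)) tame
  where
  tame : TameShape (Arrow (symMat d w))
  tame = noMutual , noAttr , noRep
  typeIIIₐ : {x y z : Fin 4} → Distinct3 x y z → TypeIII (symMat d w) x y z
  typeIIIₐ = typeIII cond4 tame
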